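{- Let $m,n$ be odd integers with $3\le m\le n$ and $m=2k+1$. Then the maximum degree of the derived multicycle satisfies $\Delta(\hat B_{m,n})\le n-k$.
   Context: The bishop graph $B_{m,n}$ has vertex set $\{(x,y): 1\le x\le n,\ 1\le y\le m\}$ (column $x$, row $y$), with $(x_1,y_1)$ adjacent to $(x_2,y_2)$ iff $|x_1-x_2|=|y_1-y_2|\ge 1$; such an edge has length $|x_1-x_2|$ and positive slope if $(x_1-x_2)(y_1-y_2)>0$, negative slope otherwise. For $1\le i\le k$, $G_i^+$ is the spanning subgraph of all edges of negative slope and length $i$ and of positive slope and length $m-i$; $G_i^-$ is that of all edges of positive slope and length $i$ and of negative slope and length $m-i$. These $2k$ subgraphs partition the edges, and each is a vertex-disjoint union of paths moving strictly rightward, so each path has a leftmost edge. The canonical coloring of $B_{m,n}$ gives the $2k$ subgraphs disjoint ordered pairs of colors from $\{1,\dots,2m-2\}$, $G_k^-$ getting the pair $(2m-3,2m-2)$, and colors each path alternately with its subgraph's two colors, the first color on the leftmost edge. The derived multicycle $\hat B_{m,n}$ is the multigraph on vertex set $\{1,\dots,m\}$ (the rows) having, for each edge $(x_1,y_1)(x_2,y_2)$ of $B_{m,n}$ colored $2m-2$ in the canonical coloring, one edge joining $y_1$ and $y_2$ (parallel edges allowed). Its maximum degree counts parallel edges. -}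

module Defs where

open import Data.Nat using (ℕ; zero; suc; _+_; _*_; _∸_; _⊔_; _≡ᵇ_; _<ᵇ_; _≤ᵇ_; ∣_-_∣)
open import Data.Bool using (Bool; true; false; _∧_; _∨_; not; if_then_else_)
open import Data.List using (List; []; _∷_; map; filter; length; foldr; concatMap; upTo)
open import Data.Maybe using (Maybe; just; nothing)
open import Data.Product using (_×_; _,_; proj₁; proj₂)
open import Relation.Nullary.Decidable using (⌊_⌋)
open import Data.Bool.Properties using (T?)

-- Bishop graph B_{m,n}: vertices (x , y), column 1 ≤ x ≤ n, row 1 ≤ y ≤ m.

Vertex : Set
Vertex = ℕ × ℕ

col row : Vertex → ℕ
col = proj₁
row = proj₂

range1 : ℕ → List ℕ
range1 n = map suc (upTo n)

vertices : (m n : ℕ) → List Vertex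
vertices m n = concatMap (λ x → map (λ y → (x , y)) (range1 m)) (range1 n)

adjacent : Vertex → Vertex → Bool
adjacent (x₁ , y₁) (x₂ , y₂) = (∣ x₁ - x₂ ∣ ≡ᵇ ∣ y₁ - y₂ ∣) ∧ (1 ≤ᵇ ∣ x₁ - x₂ ∣)

len : Vertex → Vertex → ℕ
len (x₁ , _) (x₂ , _) = ∣ x₁ - x₂ ∣

positiveSlope : Vertex → Vertex → Bool
positiveSlope (x₁ , y₁) (x₂ , y₂) =
  ((x₁ <ᵇ x₂) ∧ (y₁ <ᵇ y₂)) ∨ ((x₂ <ᵇ x₁) ∧ (y₂ <ᵇ y₁))

negativeSlope : Vertex → Vertex → Bool
negativeSlope u v = not (positiveSlope u v)

-- Edges of B_{m,n}, each listed exactly once as an ordered pair (u , v)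
-- with u the left endpoint (col u < col v); every edge has distinct columns.
Edge : Set
Edge = Vertex × Vertex

edges : (m n : ℕ) → List Edge
edges m n =
  concatMap (λ u → map (λ v → (u , v))
              (filter (λ v → T? ((col u <ᵇ col v) ∧ adjacent u v)) (vertices m n)))
            (vertices m n)

data Sign : Set where
  plus minus : Sign

inG : (m : ℕ) → Sign → (i : ℕ) → Vertex → Vertex → Bool
inG m plus  i u v = (adjacent u v ∧ negativeSlope u v ∧ (len u v ≡ᵇ i))
                  ∨ (adjacent u v ∧ positiveSlope u v ∧ (len u v ≡ᵇ (m ∸ i)))
inG m minus i u v = (adjacent u v ∧ positiveSlope u v ∧ (len u v ≡ᵇ i))
                  ∨ (adjacent u v ∧ negativeSlope u v ∧ (len u v ≡ᵇ (m ∸ i)))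

-- The left neighbour of v on its path in G (if any): a vertex u of B_{m,n}
-- strictly to the left of v with uv an edge of G (unique, as G is a union
-- of rightward paths).
leftNeighbour : (m n : ℕ) → Sign → ℕ → Vertex → Maybe Vertex
leftNeighbour m n s i v with filter (λ u → T? ((col u <ᵇ col v) ∧ inG m s i u v)) (vertices m n)
... | []      = nothing
... | u ∷ _  = just u

-- number of edges of the path (in G) lying to the left of vertex v;
-- the fuel bound n suffices because each step moves strictly left.
edgesLeftOf′ : (fuel : ℕ) → (m n : ℕ) → Sign → ℕ → Vertex → ℕ
edgesLeftOf′ zero       m n s i v = 0
edgesLeftOf′ (suc fuel) m n s i v with leftNeighbour m n s i v
... | nothing = 0
... | just u  = suc (edgesLeftOf′ fuel m n s i u)

edgesLeftOf : (m n : ℕ) → Sign → ℕ → Vertex → ℕ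
edgesLeftOf m n = edgesLeftOf′ n m n

-- position of edge (u , v) (u left endpoint) on its path: 0 for the leftmost edge
pathPosition : (m n : ℕ) → Sign → ℕ → Edge → ℕ
pathPosition m n s i (u , v) = edgesLeftOf m n s i u

isEven : ℕ → Bool
isEven zero          = true
isEven (suc zero)    = false
isEven (suc (suc j)) = isEven j

-- Canonical coloring restricted to G_k^- (pair (2m-3 , 2m-2)), m = 2k+1:
-- the path edges alternate, starting with 2m-3 on the leftmost edge.
-- Since the pairs of colours of the 2k subgraphs are disjoint, colour 2m-2
-- occurs only on edges of G_k^-.

colourGkMinus : (k n : ℕ) → Edge → ℕ
colourGkMinus k n e =
  if isEven (pathPosition (2 * k + 1) n minus k e)
  then 2 * (2 * k + 1) ∸ 3
  else 2 * (2 * k + 1) ∸ 2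

coloured2m-2 : (k n : ℕ) → Edge → Bool
coloured2m-2 k n (u , v) =
  inG m minus k u v ∧ (colourGkMinus k n (u , v) ≡ᵇ (2 * m ∸ 2))
  where m = 2 * k + 1

-- Derived multicycle \hat B_{m,n}: vertex set {1..m} (rows); one edge
-- y₁y₂ for each edge (x₁,y₁)(x₂,y₂) of colour 2m-2.  (No loops: y₁ ≠ y₂.)

derivedEdges : (k n : ℕ) → List (ℕ × ℕ)
derivedEdges k n =
  map (λ e → (row (proj₁ e) , row (proj₂ e)))
      (filter (λ e → T? (coloured2m-2 k n e)) (edges (2 * k + 1) n))

-- degree of row r in \hat B_{m,n}, counting parallel edges
derivedDegree : (k n : ℕ) → ℕ → ℕ
derivedDegree k n r =
  length (filter (λ yy → T? ((proj₁ yy ≡ᵇ r) ∨ (proj₂ yy ≡ᵇ r))) (derivedEdges k n))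

maxDegreeDerived : (k n : ℕ) → ℕ
maxDegreeDerived k n = foldr _⊔_ 0 (map (derivedDegree k n) (range1 (2 * k + 1)))

-- Colour 2m − 2 occurs only on G_k^-, whose rightward edges rise by k over k columns (from a row
-- ≤ k + 1) or fall by k + 1 over k + 1 columns (from a row ≥ k + 2).  Hence inside the grid every
-- vertex has at most one right and at most one left neighbour in G_k^-.  Colours alternate along
-- a path and its leftmost edge gets 2m − 3, so at each vertex at most one of its path edges has
-- colour 2m − 2, and none does at a vertex in the first k columns, which starts its path.  The
-- degree of row r in the derived multicycle counts the edges of colour 2m − 2 at the n vertices
-- (x , r); only the columns x > k contribute, each at most 1, so the degree is at most n − k.

module Submission where

open import Defs
open import Data.Nat using (ℕ; _+_; _*_; _∸_; _≤_; _%_)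
open import Relation.Binary.PropositionalEquality using (_≡_)

open import Data.Bool using (Bool; true; false; T; not; _∧_; _∨_; if_then_else_)
open import Data.Bool.Properties using (T?; T-∧; ∧-assoc)
open import Data.Empty using (⊥; ⊥-elim)
open import Data.List using (List; []; _∷_; [_]; _++_; map; filter; length; concatMap; upTo; cartesianProduct)
open import Data.List.Membership.Propositional using (_∈_; find; lose)
open import Data.List.Membership.Propositional.Properties
  using (∈-map⁻; ∈-upTo⁻; ∈-cartesianProduct⁻; ∈-filter⁺; ∈-filter⁻)
open import Data.List.Properties using (map-++; map-∘; map-cong; applyUpTo-∷ʳ; foldr-preservesᵇ)
open import Data.List.Relation.Unary.All as All using ()
open import Data.List.Relation.Unary.All.Properties as All using ()
open import Data.List.Relation.Unary.Any using (here; there; any?)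
open import Data.List.Relation.Unary.Unique.Propositional using (Unique; []; _∷_)
open import Data.List.Relation.Unary.Unique.Propositional.Properties as Unique using (upTo⁺; cartesianProduct⁺)
open import Data.Maybe using (just; nothing)
open import Data.Nat using (zero; suc; _<_; _<ᵇ_; _≡ᵇ_; ∣_-_∣; z≤n; s≤s; _≟_)
open import Data.Nat.ListAction using (sum)
open import Data.Nat.ListAction.Properties using (sum-++)
open import Data.Nat.Properties
open import Data.Nat.Tactic.RingSolver using (solve-∀)
open import Algebra.Properties.CommutativeSemigroup +-commutativeSemigroup using (interchange)
open import Data.Product using (_×_; _,_; proj₁; proj₂; ∃)
open import Data.Sum using (_⊎_; inj₁; inj₂)
open import Function.Base using (_∘_)
open import Function.Bundles using (Equivalence)
open import Relation.Binary.Definitions using (DecidableEquality)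
open import Relation.Binary.PropositionalEquality
  using (_≢_; refl; sym; trans; cong; cong₂; subst; module ≡-Reasoning)
open import Relation.Nullary using (¬_; yes; no)

open Equivalence using (to; from)

𝟙 : Bool → ℕ
𝟙 true  = 1
𝟙 false = 0

𝟙-¬T : ∀ {b} → ¬ T b → 𝟙 b ≡ 0
𝟙-¬T {true}  ¬t = ⊥-elim (¬t _)
𝟙-¬T {false} _  = refl

∑-syntax : ∀ {A : Set} → List A → (A → ℕ) → ℕ
∑-syntax xs f = sum (map f xs)

syntax ∑-syntax xs (λ x → e) = ∑[ x ∈ xs ] e

private
  variable
    A B : Set

∑-cong : ∀ {f g : A → ℕ} xs → (∀ x → f x ≡ g x) → ∑[ x ∈ xs ] f x ≡ ∑[ x ∈ xs ] g x
∑-cong xs f≗g = cong sum (map-cong f≗g xs)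

∑-mono-≤ : ∀ {f g : A → ℕ} xs → (∀ x → x ∈ xs → f x ≤ g x) → ∑[ x ∈ xs ] f x ≤ ∑[ x ∈ xs ] g x
∑-mono-≤ []       _  = z≤n
∑-mono-≤ (x ∷ xs) le = +-mono-≤ (le x (here refl)) (∑-mono-≤ xs (λ y y∈ → le y (there y∈)))

∑-zero : ∀ {f : A → ℕ} xs → (∀ x → x ∈ xs → f x ≡ 0) → ∑[ x ∈ xs ] f x ≡ 0
∑-zero []       _  = refl
∑-zero (x ∷ xs) z = cong₂ _+_ (z x (here refl)) (∑-zero xs (λ y y∈ → z y (there y∈)))

∑-+ : ∀ (f g : A → ℕ) xs → ∑[ x ∈ xs ] (f x + g x) ≡ ∑[ x ∈ xs ] f x + ∑[ x ∈ xs ] g x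
∑-+ f g []       = refl
∑-+ f g (x ∷ xs) = trans (cong (f x + g x +_) (∑-+ f g xs)) (interchange (f x) (g x) _ _)

∑-++ : ∀ (f : A → ℕ) xs ys → ∑[ x ∈ xs ++ ys ] f x ≡ ∑[ x ∈ xs ] f x + ∑[ x ∈ ys ] f x
∑-++ f xs ys = trans (cong sum (map-++ f xs ys)) (sum-++ (map f xs) _)

∑-swap : ∀ (F : A → B → ℕ) xs ys →
         ∑[ x ∈ xs ] ∑[ y ∈ ys ] F x y ≡ ∑[ y ∈ ys ] ∑[ x ∈ xs ] F x y
∑-swap F []       ys = sym (∑-zero ys (λ _ _ → refl))
∑-swap F (x ∷ xs) ys = trans (cong (∑[ y ∈ ys ] F x y +_) (∑-swap F xs ys))
                             (sym (∑-+ (F x) (λ y → ∑[ x′ ∈ xs ] F x′ y) ys))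

∑-map : ∀ (g : A → B) (f : B → ℕ) xs → ∑[ y ∈ map g xs ] f y ≡ ∑[ x ∈ xs ] f (g x)
∑-map g f xs = cong sum (sym (map-∘ xs))

∑-concatMap : ∀ (h : A → List B) (f : B → ℕ) xs →
              ∑[ y ∈ concatMap h xs ] f y ≡ ∑[ x ∈ xs ] ∑[ y ∈ h x ] f y
∑-concatMap h f []       = refl
∑-concatMap h f (x ∷ xs) =
  trans (∑-++ f (h x) _) (cong (∑[ y ∈ h x ] f y +_) (∑-concatMap h f xs))

length-filter≡∑𝟙 : ∀ (p : A → Bool) xs → length (filter (λ x → T? (p x)) xs) ≡ ∑[ x ∈ xs ] 𝟙 (p x)
length-filter≡∑𝟙 p []       = refl
length-filter≡∑𝟙 p (x ∷ xs) with p x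
... | true  = cong suc (length-filter≡∑𝟙 p xs)
... | false = length-filter≡∑𝟙 p xs

∑𝟙-filter : ∀ (q p : A → Bool) xs → ∑[ x ∈ filter (λ x → T? (q x)) xs ] 𝟙 (p x) ≡ ∑[ x ∈ xs ] 𝟙 (q x ∧ p x)
∑𝟙-filter q p []       = refl
∑𝟙-filter q p (x ∷ xs) with q x
... | true  = cong (𝟙 (p x) +_) (∑𝟙-filter q p xs)
... | false = ∑𝟙-filter q p xs

∑𝟙-∧ : ∀ c (p : A → Bool) xs → ∑[ x ∈ xs ] 𝟙 (c ∧ p x) ≡ (if c then ∑[ x ∈ xs ] 𝟙 (p x) else 0)
∑𝟙-∧ true  p xs = refl
∑𝟙-∧ false p xs = ∑-zero xs (λ _ _ → refl)

∑𝟙-none : ∀ {p : A → Bool} xs → (∀ x → x ∈ xs → ¬ T (p x)) → ∑[ x ∈ xs ] 𝟙 (p x) ≡ 0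
∑𝟙-none xs none = ∑-zero xs (λ x x∈ → 𝟙-¬T (none x x∈))

∑-≤-point : DecidableEquality A → ∀ {f : A → ℕ} {c} {xs} → Unique xs →
            (∀ x → x ∈ xs → x ≢ c → f x ≡ 0) → ∑[ x ∈ xs ] f x ≤ f c
∑-≤-point _≟_ []             _   = z≤n
∑-≤-point _≟_ {f = f} {c = c} {xs = x ∷ xs} (x∉xs ∷ uniq) off with x ≟ c
... | yes refl = ≤-reflexive (trans (cong (f x +_) rest≡0) (+-identityʳ (f x)))
  where
  rest≡0 : ∑[ y ∈ xs ] f y ≡ 0
  rest≡0 = ∑-zero xs (λ y y∈ → off y (there y∈) (λ y≡x → All.lookup x∉xs y∈ (sym y≡x)))
... | no x≢c rewrite off x (here refl) x≢c = ∑-≤-point _≟_ uniq (λ y y∈ → off y (there y∈))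

∑𝟙-≤1 : ∀ {p : A → Bool} {xs} → Unique xs →
        (∀ x y → x ∈ xs → y ∈ xs → T (p x) → T (p y) → x ≡ y) → ∑[ x ∈ xs ] 𝟙 (p x) ≤ 1
∑𝟙-≤1 []                             _    = z≤n
∑𝟙-≤1 {p = p} {xs = x ∷ xs} (x∉xs ∷ uniq) same with p x in px
... | true  = s≤s (≤-reflexive (∑𝟙-none xs (λ y y∈ py →
                All.lookup x∉xs y∈ (same x y (here refl) (there y∈) (subst T (sym px) _) py))))
... | false = ∑𝟙-≤1 uniq (λ y z y∈ z∈ → same y z (there y∈) (there z∈))

∑𝟙-exclusive : ∀ {p q : A → Bool} xs → (∀ x y → x ∈ xs → y ∈ xs → T (p x) → T (q y) → ⊥) →
               ∑[ x ∈ xs ] 𝟙 (p x) ≤ 1 → ∑[ x ∈ xs ] 𝟙 (q x) ≤ 1 →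
               ∑[ x ∈ xs ] 𝟙 (p x) + ∑[ x ∈ xs ] 𝟙 (q x) ≤ 1
∑𝟙-exclusive {p = p} xs excl p≤1 q≤1 with any? (λ x → T? (p x)) xs
... | yes somep with x , x∈ , px ← find somep
  rewrite ∑𝟙-none xs (λ y y∈ → excl x y x∈ y∈ px) | +-identityʳ (∑[ y ∈ xs ] 𝟙 (p y)) = p≤1
... | no nop rewrite ∑𝟙-none xs (λ x x∈ px → nop (lose x∈ px)) = q≤1

if-≤ : ∀ b a → (if b then a else 0) ≤ a
if-≤ true  a = ≤-refl
if-≤ false a = z≤n

range1-unique : ∀ n → Unique (range1 n)
range1-unique n = Unique.map⁺ suc-injective (upTo⁺ n)

∈-range1⁻ : ∀ {x n} → x ∈ range1 n → 1 ≤ x × x ≤ n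
∈-range1⁻ x∈ with ∈-map⁻ suc x∈
... | _ , i∈ , refl = s≤s z≤n , ∈-upTo⁻ i∈

range1-suc : ∀ n → range1 (suc n) ≡ range1 n ++ [ suc n ]
range1-suc n = trans (cong (map suc) (sym (applyUpTo-∷ʳ (λ i → i) n))) (map-++ suc (upTo n) [ n ])

vertices≡cartesianProduct : ∀ m n → vertices m n ≡ cartesianProduct (range1 n) (range1 m)
vertices≡cartesianProduct m n = go (range1 n)
  where
  go : ∀ xs → concatMap (λ x → map (x ,_) (range1 m)) xs ≡ cartesianProduct xs (range1 m)
  go []       = refl
  go (x ∷ xs) = cong (map (x ,_) (range1 m) ++_) (go xs)

vertices-unique : ∀ m n → Unique (vertices m n)
vertices-unique m n rewrite vertices≡cartesianProduct m n = cartesianProduct⁺ (range1-unique n) (range1-unique m)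

∈-vertices⁻ : ∀ m n {u} → u ∈ vertices m n → (1 ≤ col u × col u ≤ n) × (1 ≤ row u × row u ≤ m)
∈-vertices⁻ m n u∈ rewrite vertices≡cartesianProduct m n with ∈-cartesianProduct⁻ (range1 n) (range1 m) u∈
... | x∈ , y∈ = ∈-range1⁻ x∈ , ∈-range1⁻ y∈

∑-atRow : ∀ m n r (g : Vertex → ℕ) →
        ∑[ u ∈ vertices m n ] (if row u ≡ᵇ r then g u else 0) ≤ ∑[ x ∈ range1 n ] g (x , r)
∑-atRow m n r g = begin
  ∑[ u ∈ vertices m n ] h u                       ≡⟨ ∑-concatMap (λ x → map (x ,_) (range1 m)) h (range1 n) ⟩
  ∑[ x ∈ range1 n ] ∑[ u ∈ map (x ,_) (range1 m) ] h u ≡⟨ ∑-cong (range1 n) (λ x → ∑-map (x ,_) h (range1 m)) ⟩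
  ∑[ x ∈ range1 n ] ∑[ y ∈ range1 m ] h (x , y)   ≤⟨ ∑-mono-≤ (range1 n) (λ x _ → ∑-≤-point _≟_ (range1-unique m) (λ y _ → off x y)) ⟩
  ∑[ x ∈ range1 n ] h (x , r)                     ≤⟨ ∑-mono-≤ (range1 n) (λ x _ → if-≤ (r ≡ᵇ r) (g (x , r))) ⟩
  ∑[ x ∈ range1 n ] g (x , r)                     ∎
  where
  open ≤-Reasoning
  h : Vertex → ℕ
  h u = if row u ≡ᵇ r then g u else 0
  off : ∀ x y → y ≢ r → h (x , y) ≡ 0
  off x y y≢r with y ≡ᵇ r in e
  ... | true  = ⊥-elim (y≢r (≡ᵇ⇒≡ y r (subst T (sym e) _)))
  ... | false = refl

∑-range1-above : ∀ k n → ∑[ x ∈ range1 n ] 𝟙 (k <ᵇ x) ≡ n ∸ k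
∑-range1-above k zero    = sym (0∸n≡0 k)
∑-range1-above k (suc n) = begin
  ∑[ x ∈ range1 (suc n) ] 𝟙 (k <ᵇ x)          ≡⟨ cong (λ xs → ∑[ x ∈ xs ] 𝟙 (k <ᵇ x)) (range1-suc n) ⟩
  ∑[ x ∈ range1 n ++ [ suc n ] ] 𝟙 (k <ᵇ x)   ≡⟨ ∑-++ (λ x → 𝟙 (k <ᵇ x)) (range1 n) [ suc n ] ⟩
  ∑[ x ∈ range1 n ] 𝟙 (k <ᵇ x) + (𝟙 (k <ᵇ suc n) + 0)  ≡⟨ cong (_+ (𝟙 (k <ᵇ suc n) + 0)) (∑-range1-above k n) ⟩
  n ∸ k + (𝟙 (k <ᵇ suc n) + 0)                ≡⟨ last ⟩
  suc n ∸ k                                   ∎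
  where
  open ≡-Reasoning
  last : n ∸ k + (𝟙 (k <ᵇ suc n) + 0) ≡ suc n ∸ k
  last with k <ᵇ suc n in e
  ... | true  = trans (sym (+-∸-comm 1 (≤-pred (<ᵇ⇒< k (suc n) (subst T (sym e) _))))) (cong (_∸ k) (+-comm n 1))
  ... | false = trans (+-identityʳ _) (trans (m≤n⇒m∸n≡0 (<⇒≤ n<k)) (sym (m≤n⇒m∸n≡0 n<k)))
    where
    n<k : n < k
    n<k = ≰⇒> (λ k≤n → subst T e (<⇒<ᵇ (s≤s k≤n)))

isEven-suc : ∀ p → isEven (suc p) ≡ not (isEven p)
isEven-suc zero          = refl
isEven-suc (suc zero)    = refl
isEven-suc (suc (suc p)) = isEven-suc p

module _ (m n : ℕ) (s : Sign) (i : ℕ) where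

  leftNeighbour-sound : ∀ {u v} → leftNeighbour m n s i v ≡ just u →
                        u ∈ vertices m n × col u < col v × T (inG m s i u v)
  leftNeighbour-sound {v = v} eq
    with filter (λ u → T? ((col u <ᵇ col v) ∧ inG m s i u v)) (vertices m n) in candidates
  leftNeighbour-sound {v = v} () | []
  leftNeighbour-sound {v = v} refl | u ∷ _
    with u∈ , t ← ∈-filter⁻ (λ u → T? ((col u <ᵇ col v) ∧ inG m s i u v)) (subst (u ∈_) (sym candidates) (here refl))
    with u<v , g ← to T-∧ t
    = u∈ , <ᵇ⇒< (col u) (col v) u<v , g

  leftNeighbour-complete : ∀ {u v} → u ∈ vertices m n → col u < col v → T (inG m s i u v) →
                           ∃ λ u′ → leftNeighbour m n s i v ≡ just u′
  leftNeighbour-complete {u} {v} u∈ u<v g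
    with filter (λ u → T? ((col u <ᵇ col v) ∧ inG m s i u v)) (vertices m n) in candidates
  ... | [] with () ← subst (u ∈_) candidates
                       (∈-filter⁺ (λ u → T? ((col u <ᵇ col v) ∧ inG m s i u v)) u∈ (from T-∧ (<⇒<ᵇ u<v , g)))
  ... | u′ ∷ _ = u′ , refl

  edgesLeftOf′-nothing : ∀ f {v} → leftNeighbour m n s i v ≡ nothing → edgesLeftOf′ f m n s i v ≡ 0
  edgesLeftOf′-nothing zero    _  = refl
  edgesLeftOf′-nothing (suc f) eq rewrite eq = refl

  edgesLeftOf′-fuel : ∀ f {v} → col v ≤ f → edgesLeftOf′ f m n s i v ≡ edgesLeftOf′ (suc f) m n s i v
  edgesLeftOf′-fuel zero {v} v≤0 with leftNeighbour m n s i v in eq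
  ... | nothing = refl
  ... | just u  = ⊥-elim (n≮0 (≤-trans (proj₁ (proj₂ (leftNeighbour-sound eq))) v≤0))
  edgesLeftOf′-fuel (suc f) {v} v≤f with leftNeighbour m n s i v in eq
  ... | nothing = refl
  ... | just u  = cong suc (edgesLeftOf′-fuel f (≤-pred (≤-trans (proj₁ (proj₂ (leftNeighbour-sound eq))) v≤f)))

  edgesLeftOf-just : ∀ {u v} → leftNeighbour m n s i v ≡ just u → col v ≤ n →
                     edgesLeftOf m n s i v ≡ suc (edgesLeftOf m n s i u)
  edgesLeftOf-just {u} {v} eq = go n
    where
    u<v : col u < col v
    u<v = proj₁ (proj₂ (leftNeighbour-sound eq))
    go : ∀ f → col v ≤ f → edgesLeftOf′ f m n s i v ≡ suc (edgesLeftOf′ f m n s i u)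
    go zero    v≤0  = ⊥-elim (n≮0 (≤-trans u<v v≤0))
    go (suc f) v≤sf rewrite eq = cong suc (edgesLeftOf′-fuel f (≤-pred (≤-trans u<v v≤sf)))

2k+1≡k+suc[k] : ∀ k → 2 * k + 1 ≡ k + suc k
2k+1≡k+suc[k] = solve-∀

∣m-n∣≡o⇒n≡m+o : ∀ {a b d} → a ≤ b → ∣ a - b ∣ ≡ d → b ≡ a + d
∣m-n∣≡o⇒n≡m+o a≤b e = trans (sym (m+[n∸m]≡n a≤b)) (cong (_ +_) (trans (sym (m≤n⇒∣m-n∣≡n∸m a≤b)) e))

adjacent-diagonal : ∀ u v → T (adjacent u v) → ∣ col u - col v ∣ ≡ ∣ row u - row v ∣
adjacent-diagonal _ _ t = ≡ᵇ⇒≡ _ _ (proj₁ (to T-∧ t))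

positiveSlope⇒ascending : ∀ {u v} → col u < col v → T (positiveSlope u v) → row u < row v
positiveSlope⇒ascending {x₁ , y₁} {x₂ , y₂} x₁<x₂ pos with x₁ <ᵇ x₂ in e₁ | y₁ <ᵇ y₂ in e₂ | x₂ <ᵇ x₁ in e₃
... | false | _     | _     = ⊥-elim (subst T e₁ (<⇒<ᵇ x₁<x₂))
... | true  | true  | _     = <ᵇ⇒< y₁ y₂ (subst T (sym e₂) _)
... | true  | false | true  = ⊥-elim (<-asym x₁<x₂ (<ᵇ⇒< x₂ x₁ (subst T (sym e₃) _)))
... | true  | false | false = ⊥-elim pos

negativeSlope⇒descending : ∀ {u v} → col u < col v → T (negativeSlope u v) → row v ≤ row u
negativeSlope⇒descending {x₁ , y₁} {x₂ , y₂} x₁<x₂ neg = ≮⇒≥ ascending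
  where
  ascending : ¬ y₁ < y₂
  ascending y₁<y₂ with x₁ <ᵇ x₂ in e₁ | y₁ <ᵇ y₂ in e₂
  ... | true  | true  = neg
  ... | false | _     = subst T e₁ (<⇒<ᵇ x₁<x₂)
  ... | true  | false = subst T e₂ (<⇒<ᵇ y₁<y₂)

true≢false : true ≢ false
true≢false ()

T-∧⁻ : ∀ a b → T (a ∧ b) → T a × T b
T-∧⁻ a b = to (T-∧ {a} {b})

𝟙-∧-∨ : ∀ a b c → 𝟙 (a ∧ (b ∨ c)) ≤ 𝟙 (b ∧ a) + 𝟙 (c ∧ a)
𝟙-∧-∨ false _     _     = z≤n
𝟙-∧-∨ true  true  _     = s≤s z≤n
𝟙-∧-∨ true  false true  = ≤-refl
𝟙-∧-∨ true  false false = z≤n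

module DerivedMulticycle (k n : ℕ) where

  m : ℕ
  m = 2 * k + 1

  V : List Vertex
  V = vertices m n

  RightStep : Vertex → Vertex → Set
  RightStep u v = (col v ≡ col u + k × row v ≡ row u + k) ⊎ (col v ≡ col u + suc k × row u ≡ row v + suc k)

  inG-cases : ∀ u v → T (inG m minus k u v) →
              T (adjacent u v) × T (positiveSlope u v) × T (len u v ≡ᵇ k) ⊎
              T (adjacent u v) × T (negativeSlope u v) × T (len u v ≡ᵇ (m ∸ k))
  inG-cases u v g with adjacent u v | positiveSlope u v | len u v ≡ᵇ k
  ... | true  | true  | true  = inj₁ (_ , _ , _)
  ... | true  | false | _     = inj₂ (_ , _ , g)
  ... | true  | true  | false = ⊥-elim g
  ... | false | _     | _     = ⊥-elim g

  inG⇒RightStep : ∀ {u v} → col u < col v → T (inG m minus k u v) → RightStep u v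
  inG⇒RightStep {u} {v} u<v g with inG-cases u v g
  ... | inj₁ (adj , pos , len≡k) =
    inj₁ (∣m-n∣≡o⇒n≡m+o (<⇒≤ u<v) Δcol≡k , ∣m-n∣≡o⇒n≡m+o (<⇒≤ (positiveSlope⇒ascending u<v pos)) Δrow≡k)
    where
    Δcol≡k : ∣ col u - col v ∣ ≡ k
    Δcol≡k = ≡ᵇ⇒≡ (len u v) k len≡k
    Δrow≡k : ∣ row u - row v ∣ ≡ k
    Δrow≡k = trans (sym (adjacent-diagonal u v adj)) Δcol≡k
  ... | inj₂ (adj , neg , len≡m∸k) =
    inj₂ (∣m-n∣≡o⇒n≡m+o (<⇒≤ u<v) Δcol≡suc[k] , ∣m-n∣≡o⇒n≡m+o (negativeSlope⇒descending u<v neg) Δrow≡suc[k])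
    where
    Δcol≡suc[k] : ∣ col u - col v ∣ ≡ suc k
    Δcol≡suc[k] = trans (≡ᵇ⇒≡ (len u v) (m ∸ k) len≡m∸k) (trans (cong (_∸ k) (2k+1≡k+suc[k] k)) (m+n∸m≡n k (suc k)))
    Δrow≡suc[k] : ∣ row v - row u ∣ ≡ suc k
    Δrow≡suc[k] = trans (∣-∣-comm (row v) (row u)) (trans (sym (adjacent-diagonal u v adj)) Δcol≡suc[k])

  RightStep⇒col : ∀ {u v} → RightStep u v → col u + k ≤ col v
  RightStep⇒col (inj₁ (c , _)) = ≤-reflexive (sym c)
  RightStep⇒col (inj₂ (c , _)) = ≤-trans (+-monoʳ-≤ _ (n≤1+n k)) (≤-reflexive (sym c))

  RightStep-from-grid : ∀ {u v} → u ∈ V → RightStep u v → k < col v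
  RightStep-from-grid u∈ step = ≤-trans (+-monoˡ-≤ k (proj₁ (proj₁ (∈-vertices⁻ m n u∈)))) (RightStep⇒col step)

  m<b+[k+suc[k]] : ∀ {b} → 1 ≤ b → m < b + (k + suc k)
  m<b+[k+suc[k]] {b} 1≤b = subst (_< b + (k + suc k)) (sym (2k+1≡k+suc[k] k)) (+-monoˡ-≤ (k + suc k) 1≤b)

  -- The two kinds of step differ in height by k + (k + 1) = m rows, more than the grid allows.
  ¬up-and-down-from : ∀ {y v v′} → v ∈ V → v′ ∈ V → row v ≡ y + k → y ≡ row v′ + suc k → ⊥
  ¬up-and-down-from {y} {v} {v′} v∈ v′∈ r r′ =
    <⇒≱ (subst (m <_) (sym row-v≡) (m<b+[k+suc[k]] (proj₁ (proj₂ (∈-vertices⁻ m n v′∈))))) (proj₂ (proj₂ (∈-vertices⁻ m n v∈)))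
    where
    row-v≡ : row v ≡ row v′ + (k + suc k)
    row-v≡ = trans r (trans (cong (_+ k) r′) (trans (+-assoc (row v′) (suc k) k) (cong (row v′ +_) (+-comm (suc k) k))))

  ¬up-and-down-into : ∀ {y u u′} → u ∈ V → u′ ∈ V → y ≡ row u + k → row u′ ≡ y + suc k → ⊥
  ¬up-and-down-into {y} {u} {u′} u∈ u′∈ r r′ =
    <⇒≱ (subst (m <_) (sym row-u′≡) (m<b+[k+suc[k]] (proj₁ (proj₂ (∈-vertices⁻ m n u∈))))) (proj₂ (proj₂ (∈-vertices⁻ m n u′∈)))
    where
    row-u′≡ : row u′ ≡ row u + (k + suc k)
    row-u′≡ = trans r′ (trans (cong (_+ suc k) r) (+-assoc (row u) k (suc k)))

  RightStep-functional : ∀ {u v v′} → v ∈ V → v′ ∈ V → RightStep u v → RightStep u v′ → v ≡ v′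
  RightStep-functional _ _ (inj₁ (c , r)) (inj₁ (c′ , r′)) = cong₂ _,_ (trans c (sym c′)) (trans r (sym r′))
  RightStep-functional _ _ (inj₂ (c , r)) (inj₂ (c′ , r′)) =
    cong₂ _,_ (trans c (sym c′)) (+-cancelʳ-≡ (suc k) _ _ (trans (sym r) r′))
  RightStep-functional v∈ v′∈ (inj₁ (_ , r)) (inj₂ (_ , r′)) = ⊥-elim (¬up-and-down-from v∈ v′∈ r r′)
  RightStep-functional v∈ v′∈ (inj₂ (_ , r)) (inj₁ (_ , r′)) = ⊥-elim (¬up-and-down-from v′∈ v∈ r′ r)

  RightStep-injective : ∀ {u u′ v} → u ∈ V → u′ ∈ V → RightStep u v → RightStep u′ v → u ≡ u′
  RightStep-injective _ _ (inj₁ (c , r)) (inj₁ (c′ , r′)) =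
    cong₂ _,_ (+-cancelʳ-≡ k _ _ (trans (sym c) c′)) (+-cancelʳ-≡ k _ _ (trans (sym r) r′))
  RightStep-injective _ _ (inj₂ (c , r)) (inj₂ (c′ , r′)) =
    cong₂ _,_ (+-cancelʳ-≡ (suc k) _ _ (trans (sym c) c′)) (trans r (sym r′))
  RightStep-injective u∈ u′∈ (inj₁ (_ , r)) (inj₂ (_ , r′)) = ⊥-elim (¬up-and-down-into u∈ u′∈ r r′)
  RightStep-injective u∈ u′∈ (inj₂ (_ , r)) (inj₁ (_ , r′)) = ⊥-elim (¬up-and-down-into u′∈ u∈ r′ r)

  colouredEdge : Vertex → Vertex → Bool
  colouredEdge u v = ((col u <ᵇ col v) ∧ adjacent u v) ∧ coloured2m-2 k n (u , v)

  colouredEdge⁻ : ∀ u v → T (colouredEdge u v) →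
                  col u < col v × T (inG m minus k u v) × T (colourGkMinus k n (u , v) ≡ᵇ (2 * m ∸ 2))
  colouredEdge⁻ u v c =
    let ordered , coloured = T-∧⁻ ((col u <ᵇ col v) ∧ adjacent u v) (coloured2m-2 k n (u , v)) c
        u<v , _ = T-∧⁻ (col u <ᵇ col v) (adjacent u v) ordered
    in <ᵇ⇒< (col u) (col v) u<v , T-∧⁻ (inG m minus k u v) _ coloured

  colouredEdge⇒RightStep : ∀ u v → T (colouredEdge u v) → RightStep u v
  colouredEdge⇒RightStep u v c = let u<v , g , _ = colouredEdge⁻ u v c in inG⇒RightStep u<v g

  outDegree inDegree : Vertex → ℕ
  outDegree u = ∑[ v ∈ V ] 𝟙 (colouredEdge u v)
  inDegree  v = ∑[ u ∈ V ] 𝟙 (colouredEdge u v)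

  outDegree≤1 : ∀ u → outDegree u ≤ 1
  outDegree≤1 u = ∑𝟙-≤1 (vertices-unique m n)
    (λ v v′ v∈ v′∈ c c′ → RightStep-functional v∈ v′∈ (colouredEdge⇒RightStep u v c) (colouredEdge⇒RightStep u v′ c′))

  inDegree≤1 : ∀ v → inDegree v ≤ 1
  inDegree≤1 v = ∑𝟙-≤1 (vertices-unique m n)
    (λ u u′ u∈ u′∈ c c′ → RightStep-injective u∈ u′∈ (colouredEdge⇒RightStep u v c) (colouredEdge⇒RightStep u′ v c′))

  inDegree-firstColumns : ∀ {w} → col w ≤ k → inDegree w ≡ 0
  inDegree-firstColumns {w} w≤k = ∑𝟙-none V (λ u u∈ c → <⇒≱ (RightStep-from-grid u∈ (colouredEdge⇒RightStep u w c)) w≤k)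

  leftNeighbour-firstColumns : ∀ {w} → col w ≤ k → leftNeighbour m n minus k w ≡ nothing
  leftNeighbour-firstColumns {w} w≤k with leftNeighbour m n minus k w in eq
  ... | nothing = refl
  ... | just u  =
    let u∈ , u<w , g = leftNeighbour-sound m n minus k eq in
    ⊥-elim (<⇒≱ (RightStep-from-grid u∈ (inG⇒RightStep u<w g)) w≤k)

  derivedDegree≡ : ∀ r → derivedDegree k n r ≡ ∑[ u ∈ V ] ∑[ v ∈ V ] 𝟙 (colouredEdge u v ∧ ((row u ≡ᵇ r) ∨ (row v ≡ᵇ r)))
  derivedDegree≡ r = begin
    derivedDegree k n r
      ≡⟨ length-filter≡∑𝟙 incident (map rows (filter (λ e → T? (coloured e)) E)) ⟩
    ∑[ yy ∈ map rows (filter (λ e → T? (coloured e)) E) ] 𝟙 (incident yy)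
      ≡⟨ ∑-map rows (λ yy → 𝟙 (incident yy)) (filter (λ e → T? (coloured e)) E) ⟩
    ∑[ e ∈ filter (λ e → T? (coloured e)) E ] 𝟙 (incident (rows e))
      ≡⟨ ∑𝟙-filter coloured (λ e → incident (rows e)) E ⟩
    ∑[ e ∈ E ] 𝟙 (coloured e ∧ incident (rows e))
      ≡⟨ ∑-concatMap (λ u → map (u ,_) (filter (λ v → T? (ordered u v)) V)) (λ e → 𝟙 (coloured e ∧ incident (rows e))) V ⟩
    ∑[ u ∈ V ] ∑[ e ∈ map (u ,_) (filter (λ v → T? (ordered u v)) V) ] 𝟙 (coloured e ∧ incident (rows e))
      ≡⟨ ∑-cong V (λ u → trans (∑-map (u ,_) (λ e → 𝟙 (coloured e ∧ incident (rows e))) (filter (λ v → T? (ordered u v)) V))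
                               (∑𝟙-filter (ordered u) (λ v → coloured (u , v) ∧ incident (row u , row v)) V)) ⟩
    ∑[ u ∈ V ] ∑[ v ∈ V ] 𝟙 (ordered u v ∧ coloured (u , v) ∧ incident (row u , row v))
      ≡⟨ ∑-cong V (λ u → ∑-cong V (λ v → cong 𝟙 (∧-assoc (ordered u v) _ _))) ⟨
    ∑[ u ∈ V ] ∑[ v ∈ V ] 𝟙 (colouredEdge u v ∧ incident (row u , row v)) ∎
    where
    open ≡-Reasoning
    E : List Edge
    E = edges m n
    coloured : Edge → Bool
    coloured = coloured2m-2 k n
    ordered : Vertex → Vertex → Bool
    ordered u v = (col u <ᵇ col v) ∧ adjacent u v
    incident : ℕ × ℕ → Bool
    incident yy = (proj₁ yy ≡ᵇ r) ∨ (proj₂ yy ≡ᵇ r)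
    rows : Edge → ℕ × ℕ
    rows e = row (proj₁ e) , row (proj₂ e)

  colouredEdgesAtRow≡ : ∀ r →
    ∑[ u ∈ V ] ∑[ v ∈ V ] (𝟙 ((row u ≡ᵇ r) ∧ colouredEdge u v) + 𝟙 ((row v ≡ᵇ r) ∧ colouredEdge u v))
    ≡ ∑[ u ∈ V ] (if row u ≡ᵇ r then outDegree u else 0) + ∑[ v ∈ V ] (if row v ≡ᵇ r then inDegree v else 0)
  colouredEdgesAtRow≡ r = begin
    ∑[ u ∈ V ] ∑[ v ∈ V ] (𝟙 ((row u ≡ᵇ r) ∧ colouredEdge u v) + 𝟙 ((row v ≡ᵇ r) ∧ colouredEdge u v))
      ≡⟨ ∑-cong V (λ u → ∑-+ _ _ V) ⟩
    ∑[ u ∈ V ] (∑[ v ∈ V ] 𝟙 ((row u ≡ᵇ r) ∧ colouredEdge u v) + ∑[ v ∈ V ] 𝟙 ((row v ≡ᵇ r) ∧ colouredEdge u v))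
      ≡⟨ ∑-+ _ _ V ⟩
    ∑[ u ∈ V ] ∑[ v ∈ V ] 𝟙 ((row u ≡ᵇ r) ∧ colouredEdge u v) + ∑[ u ∈ V ] ∑[ v ∈ V ] 𝟙 ((row v ≡ᵇ r) ∧ colouredEdge u v)
      ≡⟨ cong₂ _+_ (∑-cong V (λ u → ∑𝟙-∧ (row u ≡ᵇ r) (colouredEdge u) V))
                   (trans (∑-swap (λ u v → 𝟙 ((row v ≡ᵇ r) ∧ colouredEdge u v)) V V)
                          (∑-cong V (λ v → ∑𝟙-∧ (row v ≡ᵇ r) (λ u → colouredEdge u v) V))) ⟩
    ∑[ u ∈ V ] (if row u ≡ᵇ r then outDegree u else 0) + ∑[ v ∈ V ] (if row v ≡ᵇ r then inDegree v else 0) ∎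
    where open ≡-Reasoning

  -- For k = 0 the colours 2m − 3 and 2m − 2 both truncate to 0.
  module _ (1≤k : 1 ≤ k) where

    colour≡2m-2⇒odd : ∀ b → T ((if b then 2 * m ∸ 3 else 2 * m ∸ 2) ≡ᵇ (2 * m ∸ 2)) → b ≡ false
    colour≡2m-2⇒odd true  t = ⊥-elim (∸3≢∸2 3≤2m (≡ᵇ⇒≡ (2 * m ∸ 3) (2 * m ∸ 2) t))
      where
      3≤2m : 3 ≤ 2 * m
      3≤2m = ≤-trans (+-monoˡ-≤ 1 (*-monoʳ-≤ 2 1≤k)) (m≤m+n m (m + 0))
      ∸3≢∸2 : ∀ {c} → 3 ≤ c → c ∸ 3 ≢ c ∸ 2
      ∸3≢∸2 {suc (suc (suc d))} _ = 1+n≢n ∘ sym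
      ∸3≢∸2 {suc (suc zero)} (s≤s (s≤s ()))
      ∸3≢∸2 {suc zero} (s≤s ())
    colour≡2m-2⇒odd false _ = refl

    colouredEdge⇒oddPosition : ∀ u v → T (colouredEdge u v) → isEven (edgesLeftOf m n minus k u) ≡ false
    colouredEdge⇒oddPosition u v c = colour≡2m-2⇒odd _ (proj₂ (proj₂ (colouredEdge⁻ u v c)))

    outDegree-firstColumns : ∀ {w} → col w ≤ k → outDegree w ≡ 0
    outDegree-firstColumns {w} w≤k = ∑𝟙-none V (λ v _ c → true≢false (begin
      true                                  ≡⟨⟩
      isEven 0                              ≡⟨ cong isEven (edgesLeftOf′-nothing m n minus k n (leftNeighbour-firstColumns w≤k)) ⟨
      isEven (edgesLeftOf m n minus k w)    ≡⟨ colouredEdge⇒oddPosition w v c ⟩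
      false                                 ∎))
      where open ≡-Reasoning

    colouredEdges-alternate : ∀ {u w v} → u ∈ V → col w ≤ n → T (colouredEdge u w) → T (colouredEdge w v) → ⊥
    colouredEdges-alternate {u} {w} {v} u∈ w≤n cu cw
      with u<w , g , _ ← colouredEdge⁻ u w cu
      with u′ , eq ← leftNeighbour-complete m n minus k u∈ u<w g
      with u′∈ , u′<w , g′ ← leftNeighbour-sound m n minus k eq
      = true≢false (begin
        true                                      ≡⟨ cong not (colouredEdge⇒oddPosition u w cu) ⟨
        not (isEven (edgesLeftOf m n minus k u))  ≡⟨ cong (not ∘ isEven ∘ edgesLeftOf m n minus k) u≡u′ ⟩
        not (isEven (edgesLeftOf m n minus k u′)) ≡⟨ isEven-suc (edgesLeftOf m n minus k u′) ⟨
        isEven (suc (edgesLeftOf m n minus k u′)) ≡⟨ cong isEven (edgesLeftOf-just m n minus k eq w≤n) ⟨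
        isEven (edgesLeftOf m n minus k w)        ≡⟨ colouredEdge⇒oddPosition w v cw ⟩
        false                                     ∎)
      where
      open ≡-Reasoning
      u≡u′ : u ≡ u′
      u≡u′ = RightStep-injective u∈ u′∈ (inG⇒RightStep u<w g) (inG⇒RightStep u′<w g′)

    degree-bound : ∀ w → col w ≤ n → outDegree w + inDegree w ≤ 𝟙 (k <ᵇ col w)
    degree-bound w w≤n with k <ᵇ col w in above
    ... | true  = ∑𝟙-exclusive V (λ v u _ u∈ cw cu → colouredEdges-alternate {u} {w} {v} u∈ w≤n cu cw) (outDegree≤1 w) (inDegree≤1 w)
    ... | false = ≤-reflexive (cong₂ _+_ (outDegree-firstColumns w≤k) (inDegree-firstColumns w≤k))
      where
      w≤k : col w ≤ k
      w≤k = ≮⇒≥ (λ k<w → subst T above (<⇒<ᵇ k<w))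

    derivedDegree-≤ : ∀ r → derivedDegree k n r ≤ n ∸ k
    derivedDegree-≤ r = begin
      derivedDegree k n r
        ≡⟨ derivedDegree≡ r ⟩
      ∑[ u ∈ V ] ∑[ v ∈ V ] 𝟙 (colouredEdge u v ∧ ((row u ≡ᵇ r) ∨ (row v ≡ᵇ r)))
        ≤⟨ ∑-mono-≤ V (λ u _ → ∑-mono-≤ V (λ v _ → 𝟙-∧-∨ (colouredEdge u v) (row u ≡ᵇ r) (row v ≡ᵇ r))) ⟩
      ∑[ u ∈ V ] ∑[ v ∈ V ] (𝟙 ((row u ≡ᵇ r) ∧ colouredEdge u v) + 𝟙 ((row v ≡ᵇ r) ∧ colouredEdge u v))
        ≡⟨ colouredEdgesAtRow≡ r ⟩
      ∑[ u ∈ V ] (if row u ≡ᵇ r then outDegree u else 0) + ∑[ v ∈ V ] (if row v ≡ᵇ r then inDegree v else 0)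
        ≤⟨ +-mono-≤ (∑-atRow m n r outDegree) (∑-atRow m n r inDegree) ⟩
      ∑[ x ∈ range1 n ] outDegree (x , r) + ∑[ x ∈ range1 n ] inDegree (x , r)
        ≡⟨ ∑-+ (λ x → outDegree (x , r)) (λ x → inDegree (x , r)) (range1 n) ⟨
      ∑[ x ∈ range1 n ] (outDegree (x , r) + inDegree (x , r))
        ≤⟨ ∑-mono-≤ (range1 n) (λ x x∈ → degree-bound (x , r) (proj₂ (∈-range1⁻ x∈))) ⟩
      ∑[ x ∈ range1 n ] 𝟙 (k <ᵇ x)
        ≡⟨ ∑-range1-above k n ⟩
      n ∸ k ∎
      where open ≤-Reasoning

proposition12 : (k n : ℕ) → 3 ≤ 2 * k + 1 → 2 * k + 1 ≤ n → n % 2 ≡ 1 →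
    maxDegreeDerived k n ≤ n ∸ k
proposition12 zero    n (s≤s ()) _ _
proposition12 (suc k) n _ _ _ =
  foldr-preservesᵇ {P = _≤ n ∸ suc k} ⊔-lub z≤n
    (All.map⁺ {xs = range1 (2 * suc k + 1)} (All.tabulate (λ {r} _ → DerivedMulticycle.derivedDegree-≤ (suc k) n (s≤s z≤n) r)))
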